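{- Let $T$ be a finite forest, let $v$ be a stem in $T$, let $R$ be the set of leaf neighbors of $v$, and let $r=|R|\ge1$. If $r+1$ is a triangular number, then $\mathring{s}(T)\ge \mathring{s}(T-R)+r+u_r$.
   Context: Slow-coloring game on a finite graph $G$: in each round Lister marks a nonempty set $M$ of currently uncolored vertices, scoring $|M|$ points; Painter then colors a subset of $M$ independent in $G$. The game ends when all vertices are colored. Painter minimizes and Lister maximizes the total score; the sum-color cost $\mathring{s}(G)$ is the value of the game (with $\mathring{s}$ of the graph with no vertices equal to $0$). A leaf is a vertex of degree 1; a stem in a forest is a vertex having a leaf neighbor and at most one non-leaf neighbor. For integers $k\ge0$, $t_k=\binom{k+1}{2}$; a triangular number is $t_k$ with $k\ge1$; $u_r=\max\{k\ge0:t_k\le r\}$. -}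

module Defs where

open import Data.Bool using (Bool; true; false; _∧_; not; if_then_else_)
open import Data.Nat using (ℕ; zero; suc; _+_; _≤_; _≤ᵇ_; _≡ᵇ_; _⊔_)
open import Data.Fin using (Fin)
open import Data.Fin.Subset using (Subset; _∈_; _∉_; _∩_; ∁; ∣_∣; _⊆_; Nonempty)
open import Data.Fin.Subset.Properties using (_⊆?_)
open import Data.Vec using (Vec; []; _∷_; tabulate; lookup)
open import Data.List using (List; []; _∷_; map; _++_; filter; foldr; length; upTo; allFin; last)
open import Data.Bool.ListAction using (all)
open import Data.List.Relation.Unary.Unique.Propositional using (Unique)
open import Data.List.Relation.Unary.Linked using (Linked)
open import Data.Maybe using (Maybe; just; nothing)
open import Data.Product using (Σ; _×_; ∃)
open import Relation.Binary.PropositionalEquality using (_≡_)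
open import Relation.Nullary using (¬_)
open import Relation.Nullary.Decidable using (⌊_⌋)

-- The vertex set is a subset V of Fin n; the edges
-- are the pairs {i , j} of vertices in V with adj i j ≡ true, where adj is
-- a symmetric irreflexive Boolean relation on Fin n.

record Graph : Set where
  field
    n         : ℕ
    V         : Subset n
    adj       : Fin n → Fin n → Bool
    adj-sym   : ∀ i j → adj i j ≡ adj j i
    adj-irref : ∀ i → adj i i ≡ false

open Graph public

edgeᵇ : (G : Graph) → Fin (n G) → Fin (n G) → Bool
edgeᵇ G i j = lookup (V G) i ∧ lookup (V G) j ∧ adj G i j

Adj : (G : Graph) → Fin (n G) → Fin (n G) → Set
Adj G i j = edgeᵇ G i j ≡ true

_─_ : (G : Graph) → Subset (n G) → Graph
G ─ R = record
  { n = n G ; V = V G ∩ ∁ R ; adj = adj G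
  ; adj-sym = adj-sym G ; adj-irref = adj-irref G }

N : (G : Graph) → Fin (n G) → Subset (n G)
N G v = tabulate (λ j → edgeᵇ G v j)

degree : (G : Graph) → Fin (n G) → ℕ
degree G v = ∣ N G v ∣

isLeafᵇ : (G : Graph) → Fin (n G) → Bool
isLeafᵇ G v = lookup (V G) v ∧ (degree G v ≡ᵇ 1)

Leaf : (G : Graph) → Fin (n G) → Set
Leaf G v = v ∈ V G × degree G v ≡ 1

leafNbrs : (G : Graph) → Fin (n G) → Subset (n G)
leafNbrs G v = tabulate (λ j → edgeᵇ G v j ∧ isLeafᵇ G j)

nonLeafNbrs : (G : Graph) → Fin (n G) → Subset (n G)
nonLeafNbrs G v = tabulate (λ j → edgeᵇ G v j ∧ not (isLeafᵇ G j))

record Cycle (G : Graph) : Set where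
  field
    verts     : List (Fin (n G))
    long      : 3 ≤ length verts
    distinct  : Unique verts
    path      : Linked (Adj G) verts
    closing   : ∀ {a b} → Data.List.head verts ≡ just a → last verts ≡ just b → Adj G b a

Forest : Graph → Set
Forest G = ¬ Cycle G

Stem : (G : Graph) → Fin (n G) → Set
Stem G v = v ∈ V G × (∃ λ w → Adj G v w × Leaf G w) × ∣ nonLeafNbrs G v ∣ ≤ 1

-- Triangular numbers:  t k = binom (k+1) 2

t : ℕ → ℕ
t zero    = 0
t (suc k) = suc k + t k

Triangular : ℕ → Set
Triangular m = Σ ℕ λ k → 1 ≤ k × t k ≡ m

-- u r = max { k ≥ 0 : t k ≤ r }   (any such k satisfies k ≤ t k ≤ r,
-- so the maximum is taken over k ∈ {0,…,r})
u : ℕ → ℕ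
u r = foldr _⊔_ 0 (filter (λ k → t k Data.Nat.≤? r) (upTo (suc r)))

-- A game position is the set U of currently
-- uncoloured vertices.  Lister marks a nonempty M ⊆ U (scoring ∣ M ∣),
-- Painter colours a set I ⊆ M independent in G; the game continues from
-- U \ I.  Painter choosing I = ∅ never helps (it repeats the position
-- while adding points), so the Painter's options are the nonempty ones.

allSubsets : (m : ℕ) → List (Subset m)
allSubsets zero    = [] ∷ []
allSubsets (suc m) = map (false ∷_) (allSubsets m) ++ map (true ∷_) (allSubsets m)

nonemptyᵇ : ∀ {m} → Subset m → Bool
nonemptyᵇ s = not (∣ s ∣ ≡ᵇ 0)

nonemptySubsetsOf : ∀ {m} → Subset m → List (Subset m)
nonemptySubsetsOf {m} U =
  Data.List.filterᵇ (λ M → ⌊ M ⊆? U ⌋ ∧ nonemptyᵇ M) (allSubsets m)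

independentᵇ : (G : Graph) → Subset (n G) → Bool
independentᵇ G I =
  all (λ i → all (λ j → not (lookup I i ∧ lookup I j ∧ edgeᵇ G i j)) (allFin (n G)))
      (allFin (n G))

maxL : List ℕ → ℕ
maxL = foldr _⊔_ 0

minL : List ℕ → ℕ
minL []       = 0
minL (x ∷ xs) = foldr Data.Nat._⊓_ x xs

-- value of the game from position U, with a step bound (each round colours
-- at least one vertex, so n G rounds always suffice)
gameValue : (G : Graph) → ℕ → Subset (n G) → ℕ
gameValue G zero    U = 0
gameValue G (suc k) U =
  maxL (map (λ M → ∣ M ∣ +
              minL (map (λ I → gameValue G k (U ∩ ∁ I))
                        (Data.List.filterᵇ (independentᵇ G) (nonemptySubsetsOf M))))
            (nonemptySubsetsOf U))

sc : Graph → ℕ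
sc G = gameValue G (n G) (V G)

module Submission where

-- Write value U for the value of the game from the set U of uncoloured
-- vertices and W = V T ∖ R.  The heart of the proof (leaves-bound) is, by
-- induction on k: for S ⊆ R with t (k + 1) ≤ ∣ S ∣ + 1,
--     ∣ S ∣ + (k + 1) + value W ≤ value (W ∪ S) + 1.
-- Lister marks v together with k + 1 leaves of S.  If Painter colours v,
-- use that deleting a vertex with at most one neighbour lowers the value
-- by at most 2 (pendant-vertex, proved by a Painter strategy) and that each
-- vertex of S costs at least 1 (value-∪); otherwise Painter colours at most
-- k + 1 leaves and induction applies to the rest of S.  For S = R this
-- gives the theorem, since u r ≤ k and sc (T ─ R) = value W.

open import Defs
open import Data.Nat using (ℕ; _+_; _≤_)
open import Data.Fin using (Fin)
open import Data.Fin.Subset using (∣_∣)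

open import Data.Bool using (Bool; true; false; _∧_; _∨_; not; T)
import Data.Bool as Bool
open import Data.Bool.Properties
  using ( ¬-not; ∧-zeroʳ; ∧-identityʳ; ∨-identityʳ; ∧-assoc; ∧-comm; ∧-conicalˡ; ∧-conicalʳ
        ; T-∧; T-not-≡ )
open import Data.Bool.ListAction using (all; and)
open import Data.Nat using (zero; suc; _<_; _⊓_; _⊔_; _≡ᵇ_; z≤n; s≤s)
open import Data.Nat.Properties
  using ( module ≤-Reasoning; ≤-refl; ≤-trans; ≤-antisym; ≤-reflexive; ≤-pred; _≤?_; ≰⇒>; 1+n≰n
        ; n≤1+n; m≤n+m; m<m+n; suc-injective; +-suc; +-comm; +-mono-≤; +-monoʳ-≤; +-monoˡ-≤
        ; +-cancelˡ-≤; m≤m⊔n; m≤n⊔m; ⊔-lub; m⊓n≤m; m⊓n≤n; ⊓-sel )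
open import Data.Nat.Tactic.RingSolver using (solve-∀)
open import Data.Fin using (zero; suc)
import Data.Fin as Fin
open import Data.Fin.Properties using (any?)
open import Data.Fin.Subset
  using (Subset; inside; outside; _∈_; _∉_; _⊆_; _∩_; _∪_; ∁; ⁅_⁆; ⊥; Nonempty; Empty; _-_)
  renaming (_─_ to _∖_)
open import Data.Fin.Subset.Properties
  using ( _∈?_; _⊆?_; nonempty?; x∈⁅x⁆; x∈⁅y⁆⇒x≡y; x∈p∪q⁺; x∈p∪q⁻; x∈p∩q⁺; x∈p∧x∉q⇒x∈p─q
        ; x∈p∧x≢y⇒x∈p-y; ⊥⊆; s⊆s; in⊆in; drop-∷-⊆; ⊆-refl; ⊆-antisym; p─q⊆p; Empty-unique
        ; ∪-identityʳ; p─q─r≡p─r─q; p─q─r≡p─q∪r; ∣⁅x⁆∣≡1; ∣⊥∣≡0; ∣p∣≤n; p⊆q⇒∣p∣≤∣q∣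
        ; p∩q≢∅⇒∣p─q∣<∣p∣ )
open import Data.Vec using ([]; _∷_; here; there; lookup)
open import Data.Vec.Properties
  using (lookup∘tabulate; []=⇒lookup; lookup⇒[]=; lookup-zipWith; lookup-map)
open import Data.List using (List; []; _∷_; map; allFin; filterᵇ; filter; upTo)
open import Data.List.Properties using (map-cong; map-cong-local)
import Data.List.Relation.Unary.All as All
open import Data.List.Relation.Unary.All.Properties using (all⁺; all⁻)
open import Data.List.Relation.Unary.Any using (here; there)
open import Data.List.Membership.Propositional using () renaming (_∈_ to _∈ₗ_)
open import Data.List.Membership.Propositional.Properties
  using (∈-allFin; ∈-map⁺; ∈-map⁻; ∈-++⁺ˡ; ∈-++⁺ʳ; ∈-filter⁺; ∈-filter⁻)
open import Data.Product using (_×_; _,_; ∃; proj₁; proj₂)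
open import Data.Sum using (_⊎_; inj₁; inj₂; [_,_]′)
open import Data.Empty using (⊥-elim)
open import Function using (id; _∘_; case_of_; Equivalence)
open import Relation.Nullary using (¬_; yes; no; _×-dec_)
open import Relation.Nullary.Decidable using (T?; ⌊_⌋; fromWitness; toWitness)
open import Relation.Binary.PropositionalEquality
  using (_≡_; _≢_; refl; sym; trans; cong; cong₂; subst; subst₂; module ≡-Reasoning)

maxL-upper : ∀ {x xs} → x ∈ₗ xs → x ≤ maxL xs
maxL-upper {xs = y ∷ ys} (here refl) = m≤m⊔n y (maxL ys)
maxL-upper {xs = y ∷ ys} (there x∈ys) = ≤-trans (maxL-upper x∈ys) (m≤n⊔m y (maxL ys))

maxL-least : ∀ {b} xs → (∀ {x} → x ∈ₗ xs → x ≤ b) → maxL xs ≤ b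
maxL-least []       _     = z≤n
maxL-least (y ∷ ys) bound = ⊔-lub (bound (here refl)) (maxL-least ys (bound ∘ there))

-- minL (a ∷ y ∷ ys) unfolds to  y ⊓ minL (a ∷ ys)
minL-lower : ∀ {x} a ys → x ∈ₗ a ∷ ys → minL (a ∷ ys) ≤ x
minL-lower a []       (here refl)         = ≤-refl
minL-lower a (y ∷ ys) (here refl)         = ≤-trans (m⊓n≤n y _) (minL-lower a ys (here refl))
minL-lower a (y ∷ ys) (there (here refl)) = m⊓n≤m y _
minL-lower a (y ∷ ys) (there (there x∈))  = ≤-trans (m⊓n≤n y _) (minL-lower a ys (there x∈))

minL-attained : ∀ a ys → minL (a ∷ ys) ∈ₗ a ∷ ys
minL-attained a []       = here refl
minL-attained a (y ∷ ys) with ⊓-sel y (minL (a ∷ ys))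
... | inj₁ min≡y    = there (here min≡y)
... | inj₂ min≡rest = subst (_∈ₗ a ∷ y ∷ ys) (sym min≡rest) (skip-y (minL-attained a ys))
  where
  skip-y : ∀ {z} → z ∈ₗ a ∷ ys → z ∈ₗ a ∷ y ∷ ys
  skip-y (here z≡a)  = here z≡a
  skip-y (there z∈)  = there (there z∈)

filterᵇ-cong : ∀ {A : Set} (p q : A → Bool) xs → (∀ {x} → x ∈ₗ xs → p x ≡ q x) →
               filterᵇ p xs ≡ filterᵇ q xs
filterᵇ-cong p q []       _     = refl
filterᵇ-cong p q (x ∷ xs) agree with p x | q x | agree (here refl)
... | true  | .true  | refl = cong (x ∷_) (filterᵇ-cong p q xs (agree ∘ there))
... | false | .false | refl = filterᵇ-cong p q xs (agree ∘ there)

module _ {A : Set} (f : A → ℕ) where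

  maxL-map-upper : ∀ {x xs} → x ∈ₗ xs → f x ≤ maxL (map f xs)
  maxL-map-upper x∈xs = maxL-upper (∈-map⁺ f x∈xs)

  maxL-map-least : ∀ {b} xs → (∀ {x} → x ∈ₗ xs → f x ≤ b) → maxL (map f xs) ≤ b
  maxL-map-least xs bound = maxL-least (map f xs) λ y∈ →
    let (x , x∈xs , y≡fx) = ∈-map⁻ f y∈ in subst (_≤ _) (sym y≡fx) (bound x∈xs)

  minL-map-lower : ∀ {x xs} → x ∈ₗ xs → minL (map f xs) ≤ f x
  minL-map-lower {xs = a ∷ ys} x∈xs = minL-lower (f a) (map f ys) (∈-map⁺ f x∈xs)

  minL-map-attained : ∀ {x₀ xs} → x₀ ∈ₗ xs → ∃ λ x → x ∈ₗ xs × minL (map f xs) ≡ f x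
  minL-map-attained {xs = a ∷ ys} _ = ∈-map⁻ f (minL-attained (f a) (map f ys))

-- Finite sets as bit vectors.  We write  p ∖ q  for the library's set
-- difference; the game in Defs removes coloured vertices as  U ∩ ∁ I,
-- which is the same set.

Disjoint : ∀ {m} → Subset m → Subset m → Set
Disjoint p q = ∀ {x} → x ∈ p → x ∉ q

Disjoint-tail : ∀ {m s s′} {p q : Subset m} → Disjoint (s ∷ p) (s′ ∷ q) → Disjoint p q
Disjoint-tail disjoint x∈p x∈q = disjoint (there x∈p) (there x∈q)

∩∁≡∖ : ∀ {m} (p q : Subset m) → p ∩ ∁ q ≡ p ∖ q
∩∁≡∖ []      []            = refl
∩∁≡∖ (s ∷ p) (inside  ∷ q) = cong₂ _∷_ (∧-zeroʳ s) (∩∁≡∖ p q)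
∩∁≡∖ (s ∷ p) (outside ∷ q) = cong₂ _∷_ (∧-identityʳ s) (∩∁≡∖ p q)

x∈p∖q⇒x∉q : ∀ {m} {x : Fin m} (p q : Subset m) → x ∈ p ∖ q → x ∉ q
x∈p∖q⇒x∉q (_ ∷ p) (inside  ∷ q) (there x∈) (there x∈q) = x∈p∖q⇒x∉q p q x∈ x∈q
x∈p∖q⇒x∉q (_ ∷ p) (outside ∷ q) (there x∈) (there x∈q) = x∈p∖q⇒x∉q p q x∈ x∈q

∖-disjoint : ∀ {m} (p q : Subset m) → Disjoint p q → p ∖ q ≡ p
∖-disjoint []            []            _        = refl
∖-disjoint (s ∷ p)       (outside ∷ q) disjoint = cong (s ∷_) (∖-disjoint p q (Disjoint-tail disjoint))
∖-disjoint (outside ∷ p) (inside  ∷ q) disjoint =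
  cong (outside ∷_) (∖-disjoint p q (Disjoint-tail disjoint))
∖-disjoint (inside  ∷ p) (inside  ∷ q) disjoint = ⊥-elim (disjoint here here)

∪-∖-distrib : ∀ {m} (p q r : Subset m) → (p ∪ q) ∖ r ≡ (p ∖ r) ∪ (q ∖ r)
∪-∖-distrib []      []      []            = refl
∪-∖-distrib (s ∷ p) (s′ ∷ q) (inside  ∷ r) = cong (outside ∷_) (∪-∖-distrib p q r)
∪-∖-distrib (s ∷ p) (s′ ∷ q) (outside ∷ r) = cong ((s ∨ s′) ∷_) (∪-∖-distrib p q r)

∪-∖-missˡ : ∀ {m} (p q r : Subset m) → Disjoint r p → (p ∪ q) ∖ r ≡ p ∪ (q ∖ r)
∪-∖-missˡ p q r disjoint =
  trans (∪-∖-distrib p q r) (cong (_∪ (q ∖ r)) (∖-disjoint p r (λ x∈p x∈r → disjoint x∈r x∈p)))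

∪-∖-missʳ : ∀ {m} (p q r : Subset m) → Disjoint r q → (p ∪ q) ∖ r ≡ (p ∖ r) ∪ q
∪-∖-missʳ p q r disjoint =
  trans (∪-∖-distrib p q r) (cong ((p ∖ r) ∪_) (∖-disjoint q r (λ x∈q x∈r → disjoint x∈r x∈q)))

∖-∪-restore : ∀ {m} (p q : Subset m) → q ⊆ p → (p ∖ q) ∪ q ≡ p
∖-∪-restore []            []            _   = refl
∖-∪-restore (s ∷ p)       (outside ∷ q) q⊆p = cong₂ _∷_ (∨-identityʳ s) (∖-∪-restore p q (drop-∷-⊆ q⊆p))
∖-∪-restore (inside  ∷ p) (inside  ∷ q) q⊆p = cong (inside ∷_) (∖-∪-restore p q (drop-∷-⊆ q⊆p))
∖-∪-restore (outside ∷ p) (inside  ∷ q) q⊆p with q⊆p here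
... | ()

∣∪∣-disjoint : ∀ {m} (p q : Subset m) → Disjoint p q → ∣ p ∪ q ∣ ≡ ∣ p ∣ + ∣ q ∣
∣∪∣-disjoint []            []            _        = refl
∣∪∣-disjoint (inside  ∷ p) (inside  ∷ q) disjoint = ⊥-elim (disjoint here here)
∣∪∣-disjoint (inside  ∷ p) (outside ∷ q) disjoint =
  cong suc (∣∪∣-disjoint p q (Disjoint-tail disjoint))
∣∪∣-disjoint (outside ∷ p) (inside  ∷ q) disjoint =
  trans (cong suc (∣∪∣-disjoint p q (Disjoint-tail disjoint))) (sym (+-suc ∣ p ∣ ∣ q ∣))
∣∪∣-disjoint (outside ∷ p) (outside ∷ q) disjoint = ∣∪∣-disjoint p q (Disjoint-tail disjoint)

∣∖∣-split : ∀ {m} (p q : Subset m) → q ⊆ p → ∣ p ∣ ≡ ∣ p ∖ q ∣ + ∣ q ∣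
∣∖∣-split p q q⊆p = begin
  ∣ p ∣             ≡⟨ cong ∣_∣ (sym (∖-∪-restore p q q⊆p)) ⟩
  ∣ (p ∖ q) ∪ q ∣   ≡⟨ ∣∪∣-disjoint (p ∖ q) q (x∈p∖q⇒x∉q p q) ⟩
  ∣ p ∖ q ∣ + ∣ q ∣ ∎
  where open ≡-Reasoning

⁅x⁆⊆ : ∀ {m} {x : Fin m} {p : Subset m} → x ∈ p → ⁅ x ⁆ ⊆ p
⁅x⁆⊆ {x = x} {p} x∈p y∈⁅x⁆ = subst (_∈ p) (sym (x∈⁅y⁆⇒x≡y x y∈⁅x⁆)) x∈p

∣p∣≡1+∣p-x∣ : ∀ {m} {x : Fin m} (p : Subset m) → x ∈ p → ∣ p ∣ ≡ suc ∣ p - x ∣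
∣p∣≡1+∣p-x∣ {x = x} p x∈p = begin
  ∣ p ∣                 ≡⟨ ∣∖∣-split p ⁅ x ⁆ (⁅x⁆⊆ x∈p) ⟩
  ∣ p - x ∣ + ∣ ⁅ x ⁆ ∣ ≡⟨ cong (∣ p - x ∣ +_) (∣⁅x⁆∣≡1 x) ⟩
  ∣ p - x ∣ + 1         ≡⟨ +-comm ∣ p - x ∣ 1 ⟩
  suc ∣ p - x ∣         ∎
  where open ≡-Reasoning

∣p∣≡0⇒p≡⊥ : ∀ {m} (p : Subset m) → ∣ p ∣ ≡ 0 → p ≡ ⊥
∣p∣≡0⇒p≡⊥ p ∣p∣≡0 = Empty-unique λ (x , x∈p) → case trans (sym ∣p∣≡0) (∣p∣≡1+∣p-x∣ p x∈p) of λ ()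

subset-of-size : ∀ {m} j (p : Subset m) → j ≤ ∣ p ∣ → ∃ λ q → q ⊆ p × ∣ q ∣ ≡ j
subset-of-size {m} zero p _                     = ⊥ , ⊥⊆ , ∣⊥∣≡0 m
subset-of-size (suc j) (inside  ∷ p) (s≤s j≤∣p∣) =
  let (q , q⊆p , ∣q∣≡j) = subset-of-size j p j≤∣p∣ in inside ∷ q , in⊆in q⊆p , cong suc ∣q∣≡j
subset-of-size (suc j) (outside ∷ p) j<∣p∣      =
  let (q , q⊆p , ∣q∣≡j) = subset-of-size (suc j) p j<∣p∣ in outside ∷ q , s⊆s q⊆p , ∣q∣≡j

⊆⁅x⁆ : ∀ {m} {x : Fin m} {p : Subset m} → p ⊆ ⁅ x ⁆ → Nonempty p → p ≡ ⁅ x ⁆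
⊆⁅x⁆ {x = x} {p} p⊆⁅x⁆ (y , y∈p) = ⊆-antisym p⊆⁅x⁆ λ {z} z∈⁅x⁆ →
  subst (_∈ p) (trans (x∈⁅y⁆⇒x≡y x (p⊆⁅x⁆ y∈p)) (sym (x∈⁅y⁆⇒x≡y x z∈⁅x⁆))) y∈p

⊆-remove : ∀ {m} {x : Fin m} {p q : Subset m} → p ⊆ q → x ∉ p → p ⊆ q - x
⊆-remove {x = x} p⊆q x∉p y∈p =
  x∈p∧x∉q⇒x∈p─q (p⊆q y∈p) λ y∈⁅x⁆ → x∉p (subst (_∈ _) (x∈⁅y⁆⇒x≡y x y∈⁅x⁆) y∈p)

two-elements : ∀ {m} {y z : Fin m} (p : Subset m) → y ∈ p → z ∈ p → y ≢ z → 2 ≤ ∣ p ∣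
two-elements {y = y} p y∈p z∈p y≢z =
  subst (2 ≤_) (sym (trans (∣p∣≡1+∣p-x∣ p y∈p) (cong suc (∣p∣≡1+∣p-x∣ (p - y) z∈p-y)))) (s≤s (s≤s z≤n))
  where z∈p-y = x∈p∧x≢y⇒x∈p-y z∈p (y≢z ∘ sym)

allSubsets-complete : ∀ {m} (p : Subset m) → p ∈ₗ allSubsets m
allSubsets-complete []            = here refl
allSubsets-complete {suc m} (outside ∷ p) = ∈-++⁺ˡ (∈-map⁺ (outside ∷_) (allSubsets-complete p))
allSubsets-complete {suc m} (inside  ∷ p) =
  ∈-++⁺ʳ (map (outside ∷_) (allSubsets m)) (∈-map⁺ (inside ∷_) (allSubsets-complete p))

positive⇒nonempty : ∀ {m} (p : Subset m) → 0 < ∣ p ∣ → Nonempty p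
positive⇒nonempty (inside  ∷ p) _   = zero , here
positive⇒nonempty (outside ∷ p) pos = let (x , x∈p) = positive⇒nonempty p pos in suc x , there x∈p

nonemptyᵇ⇒nonempty : ∀ {m} (p : Subset m) → T (nonemptyᵇ p) → Nonempty p
nonemptyᵇ⇒nonempty (inside  ∷ p) _ = zero , here
nonemptyᵇ⇒nonempty (outside ∷ p) ok = let (x , x∈p) = nonemptyᵇ⇒nonempty p ok in suc x , there x∈p

nonempty⇒nonemptyᵇ : ∀ {m} (p : Subset m) → Nonempty p → T (nonemptyᵇ p)
nonempty⇒nonemptyᵇ p (x , x∈p) = subst (λ c → T (not (c ≡ᵇ 0))) (sym (∣p∣≡1+∣p-x∣ p x∈p)) _

nonemptySubsets⁺ : ∀ {m} {p q : Subset m} → p ⊆ q → Nonempty p → p ∈ₗ nonemptySubsetsOf q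
nonemptySubsets⁺ {p = p} p⊆q ne =
  ∈-filter⁺ (T? ∘ _) (allSubsets-complete p)
    (Equivalence.from T-∧ (fromWitness (λ {x} → p⊆q {x}) , nonempty⇒nonemptyᵇ p ne))

nonemptySubsets⁻ : ∀ {m} {p q : Subset m} → p ∈ₗ nonemptySubsetsOf q → p ⊆ q × Nonempty p
nonemptySubsets⁻ {m} {p} {q} p∈ =
  let test = λ s → T? (⌊ s ⊆? q ⌋ ∧ nonemptyᵇ s)
      (p⊆?q , ne) = Equivalence.to T-∧ (proj₂ (∈-filter⁻ test {xs = allSubsets m} p∈))
  in (λ {x} → toWitness p⊆?q {x}) , nonemptyᵇ⇒nonempty p ne

module GraphFacts (G : Graph) where

  Independent : Subset (n G) → Set
  Independent I = ∀ {i j} → i ∈ I → j ∈ I → edgeᵇ G i j ≡ false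

  edge-irrefl : ∀ x → edgeᵇ G x x ≡ false
  edge-irrefl x = begin
    a ∧ a ∧ adj G x x ≡⟨ cong (λ b → a ∧ a ∧ b) (adj-irref G x) ⟩
    a ∧ a ∧ false     ≡⟨ cong (a ∧_) (∧-zeroʳ a) ⟩
    a ∧ false         ≡⟨ ∧-zeroʳ a ⟩
    false             ∎
    where
    open ≡-Reasoning
    a = lookup (V G) x

  edge-sym : ∀ x y → edgeᵇ G x y ≡ edgeᵇ G y x
  edge-sym x y = begin
    a ∧ b ∧ adj G x y   ≡⟨ sym (∧-assoc a b _) ⟩
    (a ∧ b) ∧ adj G x y ≡⟨ cong₂ _∧_ (∧-comm a b) (adj-sym G x y) ⟩
    (b ∧ a) ∧ adj G y x ≡⟨ ∧-assoc b a _ ⟩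
    b ∧ a ∧ adj G y x   ∎
    where
    open ≡-Reasoning
    a = lookup (V G) x
    b = lookup (V G) y

  adjacent⇒vertex : ∀ {x y} → Adj G x y → y ∈ V G
  adjacent⇒vertex {x} {y} xy =
    lookup⇒[]= y (V G) (∧-conicalˡ _ _ (∧-conicalʳ (lookup (V G) x) _ xy))

  pair-okᵇ : Subset (n G) → Fin (n G) → Fin (n G) → Bool
  pair-okᵇ I i j = not (lookup I i ∧ lookup I j ∧ edgeᵇ G i j)

  independent⇒independentᵇ : ∀ {I} → Independent I → T (independentᵇ G I)
  independent⇒independentᵇ {I} indep =
    all⁻ (λ i → all (pair-okᵇ I i) (allFin (n G))) {allFin (n G)} (All.tabulate λ {i} _ →
      all⁻ (pair-okᵇ I i) {allFin (n G)} (All.tabulate λ {j} _ → pair-ok i j))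
    where
    pair-ok : ∀ i j → T (pair-okᵇ I i j)
    pair-ok i j with lookup I i in i∈I | lookup I j in j∈I
    ... | false | _     = _
    ... | true  | false = _
    ... | true  | true  rewrite indep (lookup⇒[]= i I i∈I) (lookup⇒[]= j I j∈I) = _

  independentᵇ⇒independent : ∀ {I} → T (independentᵇ G I) → Independent I
  independentᵇ⇒independent {I} ok {i} {j} i∈I j∈I =
    pair-ok (All.lookup (all⁺ (pair-okᵇ I i) (allFin (n G))
                          (All.lookup (all⁺ (λ i → all (pair-okᵇ I i) (allFin (n G))) (allFin (n G)) ok)
                                      (∈-allFin i)))
                        (∈-allFin j))
    where
    pair-ok : T (pair-okᵇ I i j) → edgeᵇ G i j ≡ false
    pair-ok rewrite []=⇒lookup i∈I | []=⇒lookup j∈I = Equivalence.to T-not-≡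

  singleton-independent : ∀ x → Independent ⁅ x ⁆
  singleton-independent x i∈ j∈
    rewrite x∈⁅y⁆⇒x≡y x i∈ | x∈⁅y⁆⇒x≡y x j∈ = edge-irrefl x

  add-independent : ∀ {x I} → Independent I → (∀ {y} → y ∈ I → edgeᵇ G x y ≡ false) →
                    Independent (⁅ x ⁆ ∪ I)
  add-independent {x} {I} indep x-free {i} {j} i∈ j∈
    with x∈p∪q⁻ ⁅ x ⁆ I i∈ | x∈p∪q⁻ ⁅ x ⁆ I j∈
  ... | inj₁ i∈⁅x⁆ | inj₁ j∈⁅x⁆ = singleton-independent x i∈⁅x⁆ j∈⁅x⁆
  ... | inj₁ i∈⁅x⁆ | inj₂ j∈I   rewrite x∈⁅y⁆⇒x≡y x i∈⁅x⁆ = x-free j∈I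
  ... | inj₂ i∈I   | inj₁ j∈⁅x⁆ rewrite x∈⁅y⁆⇒x≡y x j∈⁅x⁆ = trans (edge-sym i x) (x-free i∈I)
  ... | inj₂ i∈I   | inj₂ j∈I   = indep i∈I j∈I

module Game (G : Graph) where
  open GraphFacts G

  Position : Set
  Position = Subset (n G)

  IsAnswer : Position → Position → Set
  IsAnswer M I = I ⊆ M × Nonempty I × Independent I

  answers : Position → List Position
  answers M = filterᵇ (independentᵇ G) (nonemptySubsetsOf M)

  answer⁺ : ∀ {M I} → IsAnswer M I → I ∈ₗ answers M
  answer⁺ (I⊆M , ne , indep) =
    ∈-filter⁺ (T? ∘ independentᵇ G) (nonemptySubsets⁺ I⊆M ne) (independent⇒independentᵇ indep)

  answer⁻ : ∀ {M I} → I ∈ₗ answers M → IsAnswer M I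
  answer⁻ {M} I∈ =
    let (I∈nonempty , ok) = ∈-filter⁻ (T? ∘ independentᵇ G) {xs = nonemptySubsetsOf M} I∈
        (I⊆M , ne)        = nonemptySubsets⁻ I∈nonempty
    in I⊆M , ne , independentᵇ⇒independent ok

  singleton-answer : ∀ {M x} → x ∈ M → IsAnswer M ⁅ x ⁆
  singleton-answer {x = x} x∈M = ⁅x⁆⊆ x∈M , (x , x∈⁅x⁆ x) , singleton-independent x

  answer-of-removed : ∀ {M I x} → IsAnswer (M - x) I → IsAnswer M I
  answer-of-removed {M} {x = x} (I⊆M-x , ne , indep) = p─q⊆p M ⁅ x ⁆ ∘ I⊆M-x , ne , indep

  add-vertex-answer : ∀ {M I x} → x ∈ M → IsAnswer (M - x) I → (∀ {y} → y ∈ I → edgeᵇ G x y ≡ false) →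
                      IsAnswer M (⁅ x ⁆ ∪ I)
  add-vertex-answer {M} {I} {x} x∈M a x-free =
    (λ y∈ → [ ⁅x⁆⊆ x∈M , proj₁ (answer-of-removed a) ]′ (x∈p∪q⁻ ⁅ x ⁆ I y∈)) ,
    (x , x∈p∪q⁺ (inj₁ (x∈⁅x⁆ x))) ,
    add-independent (proj₂ (proj₂ a)) x-free

  reply : ℕ → Position → Position → ℕ
  reply k U M = minL (map (λ I → gameValue G k (U ∖ I)) (answers M))

  gameValue-suc : ∀ k U →
    gameValue G (suc k) U ≡ maxL (map (λ M → ∣ M ∣ + reply k U M) (nonemptySubsetsOf U))
  gameValue-suc k U = cong maxL (map-cong (λ M → cong (λ costs → ∣ M ∣ + minL costs)
    (map-cong (λ I → cong (gameValue G k) (∩∁≡∖ U I)) (answers M))) (nonemptySubsetsOf U))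

  lister-move : ∀ k U {M} → M ⊆ U → Nonempty M → ∣ M ∣ + reply k U M ≤ gameValue G (suc k) U
  lister-move k U {M} M⊆U ne = subst (∣ M ∣ + reply k U M ≤_) (sym (gameValue-suc k U))
    (maxL-map-upper (λ M → ∣ M ∣ + reply k U M) (nonemptySubsets⁺ M⊆U ne))

  painter-bound : ∀ k U {b} → (∀ {M} → M ⊆ U → Nonempty M → ∣ M ∣ + reply k U M ≤ b) →
                  gameValue G (suc k) U ≤ b
  painter-bound k U {b} bound = subst (_≤ b) (sym (gameValue-suc k U))
    (maxL-map-least _ (nonemptySubsetsOf U) λ M∈ → let (M⊆U , ne) = nonemptySubsets⁻ M∈ in bound M⊆U ne)

  reply-≤ : ∀ k U {M I} → IsAnswer M I → reply k U M ≤ gameValue G k (U ∖ I)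
  reply-≤ k U a = minL-map-lower (λ I → gameValue G k (U ∖ I)) (answer⁺ a)

  reply-attained : ∀ k U {M} → Nonempty M → ∃ λ I → IsAnswer M I × reply k U M ≡ gameValue G k (U ∖ I)
  reply-attained k U (x , x∈M) =
    let (I , I∈ , eq) = minL-map-attained (λ I → gameValue G k (U ∖ I)) (answer⁺ (singleton-answer x∈M))
    in I , answer⁻ I∈ , eq

  reply-compare : ∀ {k k′ d U U′ M N} → Nonempty N →
    (∀ {I′} → IsAnswer N I′ →
       ∃ λ I → IsAnswer M I × gameValue G k (U ∖ I) ≤ d + gameValue G k′ (U′ ∖ I′)) →
    reply k U M ≤ d + reply k′ U′ N
  reply-compare {k} {k′} {d} {U} {U′} {M} {N} ne match = begin
    reply k U M                   ≤⟨ reply-≤ k U a ⟩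
    gameValue G k (U ∖ I)         ≤⟨ I-cost ⟩
    d + gameValue G k′ (U′ ∖ I′)  ≡⟨ cong (d +_) (sym best) ⟩
    d + reply k′ U′ N             ∎
    where
    open ≤-Reasoning
    I′-best = reply-attained k′ U′ ne
    I′ = proj₁ I′-best
    best = proj₂ (proj₂ I′-best)
    I-match = match (proj₁ (proj₂ I′-best))
    I = proj₁ I-match
    a = proj₁ (proj₂ I-match)
    I-cost = proj₂ (proj₂ I-match)

  answer-shrinks : ∀ {U M I} → M ⊆ U → IsAnswer M I → ∣ U ∖ I ∣ < ∣ U ∣
  answer-shrinks {U} {M} {I} M⊆U (I⊆M , (x , x∈I) , _) =
    p∩q≢∅⇒∣p─q∣<∣p∣ U I (x , x∈p∩q⁺ (M⊆U (I⊆M x∈I) , x∈I))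

  gameValue-mono : ∀ k U → gameValue G k U ≤ gameValue G (suc k) U
  gameValue-mono zero    U = z≤n
  gameValue-mono (suc k) U = painter-bound k U λ {M} M⊆U ne → ≤-trans
    (+-monoʳ-≤ ∣ M ∣ (reply-compare {k} {suc k} {0} {U} {U} {M} {M} ne λ {I} a →
      I , a , gameValue-mono k (U ∖ I)))
    (lister-move (suc k) U M⊆U ne)

  -- Each round colours a vertex, so a round bound of at least ∣ U ∣ is never binding.
  gameValue-stable : ∀ k k′ U → ∣ U ∣ ≤ k → ∣ U ∣ ≤ k′ → gameValue G k U ≤ gameValue G k′ U
  gameValue-stable zero    _        U _ _ = z≤n
  gameValue-stable (suc k) zero     U _ ∣U∣≤0 = painter-bound k U λ M⊆U (x , x∈M) →
    ⊥-elim (case subst (_≤ 0) (∣p∣≡1+∣p-x∣ U (M⊆U x∈M)) ∣U∣≤0 of λ ())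
  gameValue-stable (suc k) (suc k′) U ∣U∣≤k ∣U∣≤k′ = painter-bound k U λ {M} M⊆U ne → ≤-trans
    (+-monoʳ-≤ ∣ M ∣ (reply-compare {k} {k′} {0} {U} {U} {M} {M} ne λ {I} a →
      I , a , gameValue-stable k k′ (U ∖ I) (shrink M⊆U a ∣U∣≤k) (shrink M⊆U a ∣U∣≤k′)))
    (lister-move k′ U M⊆U ne)
    where
    shrink : ∀ {M I j} → M ⊆ U → IsAnswer M I → ∣ U ∣ ≤ suc j → ∣ U ∖ I ∣ ≤ j
    shrink M⊆U a ∣U∣≤1+j = ≤-pred (≤-trans (answer-shrinks M⊆U a) ∣U∣≤1+j)

  value : Position → ℕ
  value U = gameValue G (n G) U

  value-stable : ∀ {k} U → ∣ U ∣ ≤ k → gameValue G k U ≡ value U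
  value-stable U ∣U∣≤k =
    ≤-antisym (gameValue-stable _ _ U ∣U∣≤k (∣p∣≤n U)) (gameValue-stable _ _ U (∣p∣≤n U) ∣U∣≤k)

  lister-value : ∀ {U M} → M ⊆ U → Nonempty M → ∃ λ I → IsAnswer M I × ∣ M ∣ + value (U ∖ I) ≤ value U
  lister-value {U} {M} M⊆U (x , x∈M) = I , a , (begin
    ∣ M ∣ + value (U ∖ I)            ≡⟨ cong (∣ M ∣ +_) (sym (value-stable (U ∖ I) ∣U∖I∣≤c)) ⟩
    ∣ M ∣ + gameValue G c (U ∖ I)    ≡⟨ cong (∣ M ∣ +_) (sym best) ⟩
    ∣ M ∣ + reply c U M              ≤⟨ lister-move c U M⊆U (x , x∈M) ⟩
    gameValue G (suc c) U            ≡⟨ value-stable U (≤-reflexive ∣U∣≡1+c) ⟩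
    value U                          ∎)
    where
    open ≤-Reasoning
    c = ∣ U - x ∣
    ∣U∣≡1+c = ∣p∣≡1+∣p-x∣ U (M⊆U x∈M)
    I-best = reply-attained c U (x , x∈M)
    I = proj₁ I-best
    a = proj₁ (proj₂ I-best)
    best = proj₂ (proj₂ I-best)
    ∣U∖I∣≤c = ≤-pred (subst (∣ U ∖ I ∣ <_) ∣U∣≡1+c (answer-shrinks M⊆U a))

  value-remove : ∀ {U x} → x ∈ U → suc (value (U - x)) ≤ value U
  value-remove {U} {x} x∈U =
    let (I , (I⊆⁅x⁆ , ne , _) , bound) = lister-value (⁅x⁆⊆ x∈U) (x , x∈⁅x⁆ x)
    in subst₂ (λ c J → c + value (U ∖ J) ≤ value U) (∣⁅x⁆∣≡1 x) (⊆⁅x⁆ I⊆⁅x⁆ ne) bound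

  value-∪ : ∀ {W S} → Disjoint S W → ∣ S ∣ + value W ≤ value (W ∪ S)
  value-∪ {W} = by-size _ refl
    where
    open ≤-Reasoning
    by-size : ∀ s {S} → ∣ S ∣ ≡ s → Disjoint S W → ∣ S ∣ + value W ≤ value (W ∪ S)
    by-size zero {S} ∣S∣≡0 _ = begin
      ∣ S ∣ + value W ≡⟨ cong (_+ value W) ∣S∣≡0 ⟩
      value W         ≡⟨ cong value (sym (∪-identityʳ W)) ⟩
      value (W ∪ ⊥)   ≡⟨ cong (λ S → value (W ∪ S)) (sym (∣p∣≡0⇒p≡⊥ S ∣S∣≡0)) ⟩
      value (W ∪ S)   ∎
    by-size (suc s) {S} ∣S∣≡1+s S∩W=∅ = begin
      ∣ S ∣ + value W            ≡⟨ cong (_+ value W) (∣p∣≡1+∣p-x∣ S x∈S) ⟩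
      suc (∣ S - x ∣ + value W)  ≤⟨ s≤s (by-size s ∣S-x∣≡s (S∩W=∅ ∘ p─q⊆p S ⁅ x ⁆)) ⟩
      suc (value (W ∪ (S - x)))  ≡⟨ cong (suc ∘ value) (sym (∪-∖-missˡ W S ⁅ x ⁆ x∉W)) ⟩
      suc (value ((W ∪ S) - x))  ≤⟨ value-remove (x∈p∪q⁺ (inj₂ x∈S)) ⟩
      value (W ∪ S)              ∎
      where
      some-x = positive⇒nonempty S (subst (0 <_) (sym ∣S∣≡1+s) (s≤s z≤n))
      x = proj₁ some-x
      x∈S = proj₂ some-x
      ∣S-x∣≡s = suc-injective (trans (sym (∣p∣≡1+∣p-x∣ S x∈S)) ∣S∣≡1+s)
      x∉W : Disjoint ⁅ x ⁆ W
      x∉W y∈⁅x⁆ = S∩W=∅ (subst (_∈ S) (sym (x∈⁅y⁆⇒x≡y x y∈⁅x⁆)) x∈S)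

module PainterBounds (G : Graph) where
  open GraphFacts G
  open Game G

  NoNeighbourIn : Fin (n G) → Position → Set
  NoNeighbourIn x U = ∀ {y} → y ∈ U → edgeᵇ G x y ≡ false

  AtMostOneNeighbourIn : Fin (n G) → Position → Set
  AtMostOneNeighbourIn x U = ∀ {y z} → y ∈ U → z ∈ U → Adj G x y → Adj G x z → y ≡ z

  -- Painter's strategy behind both bounds: answer as in the position U - x,
  -- except that when x is marked together with other vertices M - x,
  -- Painter answers M - x as there and then adjusts the answer (respond).
  -- later bounds the cost of the continuation by induction.
  deletion-step : ∀ c k U x →
    (∀ I → gameValue G k (U ∖ I) ≤ suc c + gameValue G k ((U - x) ∖ I)) →
    (∀ {M I′} → M ⊆ U → x ∈ M → IsAnswer (M - x) I′ →
       ∃ λ I → IsAnswer M I × gameValue G k (U ∖ I) ≤ c + gameValue G k ((U - x) ∖ I′)) →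
    gameValue G (suc k) U ≤ suc c + gameValue G (suc k) (U - x)
  deletion-step c k U x later respond = painter-bound k U bound
    where
    open ≤-Reasoning
    target = suc c + gameValue G (suc k) (U - x)

    swap-front : ∀ a b c → a + (b + c) ≡ b + (a + c)
    swap-front = solve-∀

    x-unmarked : ∀ {M} → M ⊆ U → Nonempty M → x ∉ M → ∣ M ∣ + reply k U M ≤ target
    x-unmarked {M} M⊆U ne x∉M = begin
      ∣ M ∣ + reply k U M                   ≤⟨ +-monoʳ-≤ ∣ M ∣ (reply-compare {k} {k} {suc c} {U} {U - x} {M} {M} ne
                                                  λ {I} a → I , a , later I) ⟩
      ∣ M ∣ + (suc c + reply k (U - x) M)   ≡⟨ swap-front ∣ M ∣ (suc c) _ ⟩
      suc c + (∣ M ∣ + reply k (U - x) M)   ≤⟨ +-monoʳ-≤ (suc c) (lister-move k (U - x) (⊆-remove M⊆U x∉M) ne) ⟩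
      target                                ∎

    x-marked-with-others : ∀ {M} → M ⊆ U → x ∈ M → Nonempty (M - x) → ∣ M ∣ + reply k U M ≤ target
    x-marked-with-others {M} M⊆U x∈M ne = begin
      ∣ M ∣ + reply k U M                             ≡⟨ cong (_+ reply k U M) (∣p∣≡1+∣p-x∣ M x∈M) ⟩
      suc (∣ M - x ∣ + reply k U M)                   ≤⟨ s≤s (+-monoʳ-≤ ∣ M - x ∣
                                                            (reply-compare {k} {k} {c} {U} {U - x} {M} {M - x} ne
                                                               (respond M⊆U x∈M))) ⟩
      suc (∣ M - x ∣ + (c + reply k (U - x) (M - x))) ≡⟨ cong suc (swap-front ∣ M - x ∣ c _) ⟩
      suc c + (∣ M - x ∣ + reply k (U - x) (M - x))   ≤⟨ +-monoʳ-≤ (suc c) (lister-move k (U - x) M-x⊆U-x ne) ⟩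
      target                                          ∎
      where
      M-x⊆U-x : M - x ⊆ U - x
      M-x⊆U-x = ⊆-remove (M⊆U ∘ p─q⊆p M ⁅ x ⁆) (λ x∈M-x → x∈p∖q⇒x∉q M ⁅ x ⁆ x∈M-x (x∈⁅x⁆ x))

    x-marked-alone : ∀ {M} → x ∈ M → Empty (M - x) → ∣ M ∣ + reply k U M ≤ target
    x-marked-alone {M} x∈M empty = begin
      ∣ M ∣ + reply k U M               ≡⟨ cong (_+ reply k U M) ∣M∣≡1 ⟩
      suc (reply k U M)                 ≤⟨ s≤s (reply-≤ k U (singleton-answer x∈M)) ⟩
      suc (gameValue G k (U - x))       ≤⟨ s≤s (gameValue-mono k (U - x)) ⟩
      suc (gameValue G (suc k) (U - x)) ≤⟨ s≤s (m≤n+m _ c) ⟩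
      target                            ∎
      where
      ∣M∣≡1 : ∣ M ∣ ≡ 1
      ∣M∣≡1 = trans (∣p∣≡1+∣p-x∣ M x∈M) (cong suc (trans (cong ∣_∣ (Empty-unique empty)) (∣⊥∣≡0 (n G))))

    bound : ∀ {M} → M ⊆ U → Nonempty M → ∣ M ∣ + reply k U M ≤ target
    bound {M} M⊆U ne with x ∈? M
    ... | no x∉M = x-unmarked M⊆U ne x∉M
    ... | yes x∈M with nonempty? (M - x)
    ...   | yes ne′  = x-marked-with-others M⊆U x∈M ne′
    ...   | no empty = x-marked-alone x∈M empty

  remove-later : ∀ (U I : Position) x → (U ∖ I) - x ≡ (U - x) ∖ I
  remove-later U I x = p─q─r≡p─r─q U I ⁅ x ⁆

  remove-together : ∀ (U I : Position) x → U ∖ (⁅ x ⁆ ∪ I) ≡ (U - x) ∖ I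
  remove-together U I x = sym (p─q─r≡p─q∪r U ⁅ x ⁆ I)

  -- An isolated vertex is always coloured with the answer it is marked in.
  isolated-vertex : ∀ k U x → NoNeighbourIn x U → gameValue G k U ≤ suc (gameValue G k (U - x))
  isolated-vertex zero    U x _        = z≤n
  isolated-vertex (suc k) U x isolated = deletion-step 0 k U x later respond
    where
    later : ∀ I → gameValue G k (U ∖ I) ≤ suc (gameValue G k ((U - x) ∖ I))
    later I = subst (λ P → gameValue G k (U ∖ I) ≤ suc (gameValue G k P)) (remove-later U I x)
                (isolated-vertex k (U ∖ I) x (isolated ∘ p─q⊆p U I))
    respond : ∀ {M I′} → M ⊆ U → x ∈ M → IsAnswer (M - x) I′ →
              ∃ λ I → IsAnswer M I × gameValue G k (U ∖ I) ≤ gameValue G k ((U - x) ∖ I′)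
    respond {M} {I′} M⊆U x∈M a′ =
      ⁅ x ⁆ ∪ I′ ,
      add-vertex-answer x∈M a′ (isolated ∘ M⊆U ∘ proj₁ (answer-of-removed a′)) ,
      ≤-reflexive (cong (gameValue G k) (remove-together U I′ x))

  -- A vertex with one neighbour y: when y is coloured, x becomes isolated;
  -- otherwise x is coloured together with Painter's answer.
  pendant-vertex : ∀ k U x → AtMostOneNeighbourIn x U → gameValue G k U ≤ 2 + gameValue G k (U - x)
  pendant-vertex zero    U x _       = z≤n
  pendant-vertex (suc k) U x pendant = deletion-step 1 k U x later respond
    where
    later : ∀ I → gameValue G k (U ∖ I) ≤ 2 + gameValue G k ((U - x) ∖ I)
    later I = subst (λ P → gameValue G k (U ∖ I) ≤ 2 + gameValue G k P) (remove-later U I x)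
                (pendant-vertex k (U ∖ I) x (λ y∈ z∈ → pendant (p─q⊆p U I y∈) (p─q⊆p U I z∈)))
    respond : ∀ {M I′} → M ⊆ U → x ∈ M → IsAnswer (M - x) I′ →
              ∃ λ I → IsAnswer M I × gameValue G k (U ∖ I) ≤ 1 + gameValue G k ((U - x) ∖ I′)
    respond {M} {I′} M⊆U x∈M a′ with any? (λ y → y ∈? I′ ×-dec (edgeᵇ G x y Bool.≟ true))
    ... | yes (y , y∈I′ , xy) =
      I′ , answer-of-removed a′ ,
      subst (λ P → gameValue G k (U ∖ I′) ≤ 1 + gameValue G k P) (remove-later U I′ x)
        (isolated-vertex k (U ∖ I′) x x-isolated)
      where
      -- y is the only neighbour of x, and it has been coloured
      y∈U : y ∈ U
      y∈U = M⊆U (proj₁ (answer-of-removed a′) y∈I′)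
      x-isolated : NoNeighbourIn x (U ∖ I′)
      x-isolated {z} z∈ = ¬-not λ xz →
        x∈p∖q⇒x∉q U I′ z∈ (subst (_∈ I′) (pendant y∈U (p─q⊆p U I′ z∈) xy xz) y∈I′)
    ... | no no-neighbour =
      ⁅ x ⁆ ∪ I′ ,
      add-vertex-answer x∈M a′ (λ {y} y∈ → ¬-not λ xy → no-neighbour (y , y∈ , xy)) ,
      ≤-trans (≤-reflexive (cong (gameValue G k) (remove-together U I′ x))) (n≤1+n _)

module Deletion (G : Graph) (Q : Subset (n G)) where

  vertex-kept : ∀ {i} → i ∉ Q → lookup (V G ∩ ∁ Q) i ≡ lookup (V G) i
  vertex-kept {i} i∉Q = begin
    lookup (V G ∩ ∁ Q) i             ≡⟨ lookup-zipWith _∧_ i (V G) (∁ Q) ⟩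
    lookup (V G) i ∧ lookup (∁ Q) i  ≡⟨ cong (lookup (V G) i ∧_) (trans (lookup-map i not Q) (cong not i∉Qᵇ)) ⟩
    lookup (V G) i ∧ true            ≡⟨ ∧-identityʳ _ ⟩
    lookup (V G) i                   ∎
    where
    open ≡-Reasoning
    i∉Qᵇ : lookup Q i ≡ false
    i∉Qᵇ = ¬-not (i∉Q ∘ lookup⇒[]= i Q)

  independentᵇ-kept : ∀ {I} → Disjoint I Q → independentᵇ (G ─ Q) I ≡ independentᵇ G I
  independentᵇ-kept {I} I∩Q=∅ =
    cong and (map-cong (λ i → cong and (map-cong (pair-kept i) (allFin (n G)))) (allFin (n G)))
    where
    pair-kept : ∀ i j → GraphFacts.pair-okᵇ (G ─ Q) I i j ≡ GraphFacts.pair-okᵇ G I i j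
    pair-kept i j with lookup I i in i∈I | lookup I j in j∈I
    ... | false | _     = refl
    ... | true  | false = refl
    ... | true  | true  = cong₂ (λ a b → not (a ∧ b ∧ adj G i j))
            (vertex-kept (I∩Q=∅ (lookup⇒[]= i I i∈I))) (vertex-kept (I∩Q=∅ (lookup⇒[]= j I j∈I)))

  gameValue-deletion : ∀ k U → Disjoint U Q → gameValue (G ─ Q) k U ≡ gameValue G k U
  gameValue-deletion zero    U _       = refl
  gameValue-deletion (suc k) U U∩Q=∅ = begin
    gameValue (G ─ Q) (suc k) U                                   ≡⟨ Game.gameValue-suc (G ─ Q) k U ⟩
    maxL (map (λ M → ∣ M ∣ + Game.reply (G ─ Q) k U M) markings)  ≡⟨ cong maxL (map-cong-local (All.tabulate λ M∈ →
                                                                       cong (_ +_) (reply-kept (proj₁ (nonemptySubsets⁻ M∈))))) ⟩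
    maxL (map (λ M → ∣ M ∣ + Game.reply G k U M) markings)        ≡⟨ sym (Game.gameValue-suc G k U) ⟩
    gameValue G (suc k) U                                         ∎
    where
    open ≡-Reasoning
    markings = nonemptySubsetsOf U
    reply-kept : ∀ {M} → M ⊆ U → Game.reply (G ─ Q) k U M ≡ Game.reply G k U M
    reply-kept {M} M⊆U = cong minL (trans
      (cong (map (λ I → gameValue (G ─ Q) k (U ∖ I)))
        (filterᵇ-cong _ _ (nonemptySubsetsOf M) λ I∈ →
          independentᵇ-kept (U∩Q=∅ ∘ M⊆U ∘ proj₁ (nonemptySubsets⁻ I∈))))
      (map-cong-local (All.tabulate λ {I} _ → gameValue-deletion k (U ∖ I) (U∩Q=∅ ∘ p─q⊆p U I))))

  sc-deletion : sc (G ─ Q) ≡ Game.value G (V G ∖ Q)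
  sc-deletion =
    trans (gameValue-deletion (n G) (V G ∩ ∁ Q) avoids-Q) (cong (gameValue G (n G)) (∩∁≡∖ (V G) Q))
    where
    avoids-Q : Disjoint (V G ∩ ∁ Q) Q
    avoids-Q x∈ = x∈p∖q⇒x∉q (V G) Q (subst (_ ∈_) (∩∁≡∖ (V G) Q) x∈)

-- Triangular numbers: t is monotone, so  t (k + 1) = r + 1  forces  u r ≤ k.
t-mono : ∀ {a b} → a ≤ b → t a ≤ t b
t-mono z≤n       = z≤n
t-mono (s≤s a≤b) = +-mono-≤ (s≤s a≤b) (t-mono a≤b)

u-below : ∀ r k → t (suc k) ≡ suc r → u r ≤ k
u-below r k t[k+1]≡r+1 =
  maxL-least (filter (λ j → t j ≤? r) (upTo (suc r))) λ j∈ →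
    below (proj₂ (∈-filter⁻ (λ j → t j ≤? r) {xs = upTo (suc r)} j∈))
  where
  open ≤-Reasoning
  below : ∀ {j} → t j ≤ r → j ≤ k
  below {j} tj≤r with j ≤? k
  ... | yes j≤k = j≤k
  ... | no  j≰k = ⊥-elim (1+n≰n (begin
    suc r      ≡⟨ sym t[k+1]≡r+1 ⟩
    t (suc k)  ≤⟨ t-mono (≰⇒> j≰k) ⟩
    t j        ≤⟨ tj≤r ⟩
    r          ∎))

module StemLeaves (T : Graph) (v : Fin (n T)) (stem : Stem T v) where
  open GraphFacts T
  open Game T
  open PainterBounds T

  R W : Position
  R = leafNbrs T v
  W = V T ∖ R

  leaf-neighbourᵇ : ∀ y → lookup R y ≡ edgeᵇ T v y ∧ isLeafᵇ T y
  leaf-neighbourᵇ = lookup∘tabulate _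

  R-adjacent : ∀ {y} → y ∈ R → Adj T v y
  R-adjacent {y} y∈R = ∧-conicalˡ _ _ (trans (sym (leaf-neighbourᵇ y)) ([]=⇒lookup y∈R))

  v∉R : v ∉ R
  v∉R v∈R = case trans (sym (edge-irrefl v)) (R-adjacent v∈R) of λ ()

  v∈W : v ∈ W
  v∈W = x∈p∧x∉q⇒x∈p─q (proj₁ stem) v∉R

  R∩W=∅ : Disjoint R W
  R∩W=∅ y∈R y∈W = x∈p∖q⇒x∉q (V T) R y∈W y∈R

  V≡W∪R : V T ≡ W ∪ R
  V≡W∪R = sym (∖-∪-restore (V T) R (adjacent⇒vertex ∘ R-adjacent))

  -- the neighbours of v in W are non-leaves, and a stem has at most one of those
  v-pendant-in-W : AtMostOneNeighbourIn v W
  v-pendant-in-W {y} {z} y∈W z∈W vy vz with y Fin.≟ z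
  ... | yes y≡z = y≡z
  ... | no  y≢z = ⊥-elim (case ≤-trans two-non-leaves (proj₂ (proj₂ stem)) of λ { (s≤s ()) })
    where
    non-leaf : ∀ {x} → x ∈ W → Adj T v x → x ∈ nonLeafNbrs T v
    non-leaf {x} x∈W vx =
      lookup⇒[]= x _ (trans (lookup∘tabulate _ x) (cong₂ (λ a b → a ∧ not b) vx x-not-leaf))
      where
      x-not-leaf : isLeafᵇ T x ≡ false
      x-not-leaf = ¬-not λ leaf →
        x∈p∖q⇒x∉q (V T) R x∈W (lookup⇒[]= x R (trans (leaf-neighbourᵇ x) (cong₂ _∧_ vx leaf)))
    two-non-leaves = two-elements (nonLeafNbrs T v) (non-leaf y∈W vy) (non-leaf z∈W vz) y≢z

  LeavesBound : ℕ → Set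
  LeavesBound k = ∀ {S} → S ⊆ R → t (suc k) ≤ suc ∣ S ∣ → ∣ S ∣ + suc k + value W ≤ suc (value (W ∪ S))

  leaves-base : LeavesBound 0
  leaves-base {S} S⊆R _ = begin
    ∣ S ∣ + 1 + value W        ≡⟨ cong (_+ value W) (+-comm ∣ S ∣ 1) ⟩
    suc (∣ S ∣ + value W)      ≤⟨ s≤s (value-∪ (R∩W=∅ ∘ S⊆R)) ⟩
    suc (value (W ∪ S))        ∎
    where open ≤-Reasoning

  -- Painter's answer to v together with leaves J is ⁅ v ⁆ or a set of leaves,
  -- as the leaves are adjacent to v.
  answer-at-stem : ∀ {J I} → J ⊆ R → IsAnswer (⁅ v ⁆ ∪ J) I → I ≡ ⁅ v ⁆ ⊎ I ⊆ J
  answer-at-stem {J} {I} J⊆R (I⊆M , _ , I-independent) with v ∈? I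
  ... | yes v∈I = inj₁ (⊆⁅x⁆ I⊆⁅v⁆ (v , v∈I))
    where
    I⊆⁅v⁆ : I ⊆ ⁅ v ⁆
    I⊆⁅v⁆ {y} y∈I = [ id , (λ y∈J → ⊥-elim (not-adjacent (R-adjacent (J⊆R y∈J)))) ]′ (x∈p∪q⁻ ⁅ v ⁆ J (I⊆M y∈I))
      where
      not-adjacent : ¬ Adj T v y
      not-adjacent vy = case trans (sym (I-independent v∈I y∈I)) vy of λ ()
  ... | no v∉I = inj₂ λ {y} y∈I →
    [ (λ y∈⁅v⁆ → ⊥-elim (v∉I (subst (_∈ I) (x∈⁅y⁆⇒x≡y v y∈⁅v⁆) y∈I))) , id ]′ (x∈p∪q⁻ ⁅ v ⁆ J (I⊆M y∈I))

  -- If Painter colours v, the pendant bound at v and value-∪ for S suffice.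
  v-coloured : ∀ m {S} → S ⊆ R → ∣ S ∣ + m + value W ≤ suc (suc m + value ((W - v) ∪ S))
  v-coloured m {S} S⊆R = begin
    ∣ S ∣ + m + value W                      ≤⟨ +-monoʳ-≤ (∣ S ∣ + m) (pendant-vertex (n T) W v v-pendant-in-W) ⟩
    ∣ S ∣ + m + (2 + value (W - v))          ≡⟨ rearrange ∣ S ∣ m (value (W - v)) ⟩
    suc (suc m + (∣ S ∣ + value (W - v)))    ≤⟨ s≤s (+-monoʳ-≤ (suc m) (value-∪ S∩[W-v]=∅)) ⟩
    suc (suc m + value ((W - v) ∪ S))        ∎
    where
    open ≤-Reasoning
    rearrange : ∀ s m x → s + m + (2 + x) ≡ suc (suc m + (s + x))
    rearrange = solve-∀
    S∩[W-v]=∅ : Disjoint S (W - v)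
    S∩[W-v]=∅ y∈S y∈W-v = R∩W=∅ (S⊆R y∈S) (p─q⊆p W ⁅ v ⁆ y∈W-v)

  -- If Painter colours a set I ⊆ S of at most m = k + 2 leaves, the
  -- induction hypothesis applies to the remaining leaves S ∖ I.
  leaves-coloured : ∀ k → LeavesBound k → ∀ {S I} → S ⊆ R → I ⊆ S → ∣ I ∣ ≤ suc (suc k) →
    t (suc (suc k)) ≤ suc ∣ S ∣ → ∣ S ∣ + suc (suc k) + value W ≤ suc (suc (suc (suc k)) + value (W ∪ (S ∖ I)))
  leaves-coloured k induction {S} {I} S⊆R I⊆S a≤m budget = begin
    s + m + value W                  ≡⟨ cong (λ c → c + m + value W) ∣S∣≡ ⟩
    s′ + a + m + value W             ≡⟨ rearrange s′ a k (value W) ⟩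
    a + suc (s′ + suc k + value W)   ≤⟨ +-monoʳ-≤ a (s≤s (induction (S⊆R ∘ p─q⊆p S I) budget′)) ⟩
    a + suc (suc (value (W ∪ S′)))   ≤⟨ +-monoˡ-≤ _ a≤m ⟩
    m + suc (suc (value (W ∪ S′)))   ≡⟨ rearrange′ m (value (W ∪ S′)) ⟩
    suc (suc m + value (W ∪ S′))     ∎
    where
    open ≤-Reasoning
    rearrange : ∀ s′ a k x → s′ + a + suc (suc k) + x ≡ a + suc (s′ + suc k + x)
    rearrange = solve-∀
    rearrange′ : ∀ m y → m + suc (suc y) ≡ suc (suc m + y)
    rearrange′ = solve-∀
    m = suc (suc k)
    S′ = S ∖ I
    s = ∣ S ∣
    s′ = ∣ S′ ∣
    a = ∣ I ∣
    ∣S∣≡ : s ≡ s′ + a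
    ∣S∣≡ = ∣∖∣-split S I I⊆S
    budget′ : t (suc k) ≤ suc s′
    budget′ = +-cancelˡ-≤ m _ _ (begin
      m + t (suc k)     ≤⟨ budget ⟩
      suc s             ≡⟨ cong suc ∣S∣≡ ⟩
      suc (s′ + a)      ≤⟨ s≤s (+-monoʳ-≤ s′ a≤m) ⟩
      suc (s′ + m)      ≡⟨ cong suc (+-comm s′ m) ⟩
      suc (m + s′)      ≡⟨ sym (+-suc m s′) ⟩
      m + suc s′        ∎)

  -- Lister marks v together with m = k + 2 leaves J ⊆ S; m ≤ ∣ S ∣ as
  -- m < t m ≤ ∣ S ∣ + 1.
  leaves-step : ∀ k → LeavesBound k → LeavesBound (suc k)
  leaves-step k induction {S} S⊆R budget =
    ≤-trans after-answer (s≤s (subst (λ c → c + value (U ∖ I) ≤ value U) ∣M∣≡1+m I-bound))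
    where
    m = suc (suc k)
    U = W ∪ S
    m≤∣S∣ : m ≤ ∣ S ∣
    m≤∣S∣ = ≤-pred (≤-trans (m<m+n m (s≤s z≤n)) budget)
    J-choice = subset-of-size m S m≤∣S∣
    J = proj₁ J-choice
    J⊆S = proj₁ (proj₂ J-choice)
    ∣J∣≡m = proj₂ (proj₂ J-choice)
    v∉S : Disjoint ⁅ v ⁆ S
    v∉S y∈⁅v⁆ y∈S = v∉R (subst (_∈ R) (x∈⁅y⁆⇒x≡y v y∈⁅v⁆) (S⊆R y∈S))
    M = ⁅ v ⁆ ∪ J
    ∣M∣≡1+m : ∣ M ∣ ≡ suc m
    ∣M∣≡1+m = trans (∣∪∣-disjoint ⁅ v ⁆ J (λ y∈ → v∉S y∈ ∘ J⊆S)) (cong₂ _+_ (∣⁅x⁆∣≡1 v) ∣J∣≡m)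
    M⊆U : M ⊆ U
    M⊆U y∈M = [ (λ y∈⁅v⁆ → x∈p∪q⁺ (inj₁ (⁅x⁆⊆ v∈W y∈⁅v⁆))) , (λ y∈J → x∈p∪q⁺ (inj₂ (J⊆S y∈J))) ]′
                (x∈p∪q⁻ ⁅ v ⁆ J y∈M)
    I-choice = lister-value M⊆U (v , x∈p∪q⁺ (inj₁ (x∈⁅x⁆ v)))
    I = proj₁ I-choice
    I-bound = proj₂ (proj₂ I-choice)

    after-answer : ∣ S ∣ + m + value W ≤ suc (suc m + value (U ∖ I))
    after-answer with answer-at-stem (S⊆R ∘ J⊆S) (proj₁ (proj₂ I-choice))
    ... | inj₁ I≡⁅v⁆ = subst (λ P → ∣ S ∣ + m + value W ≤ suc (suc m + value P)) (sym U∖I≡) (v-coloured m S⊆R)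
      where
      U∖I≡ : U ∖ I ≡ (W - v) ∪ S
      U∖I≡ = trans (cong (U ∖_) I≡⁅v⁆) (∪-∖-missʳ W S ⁅ v ⁆ v∉S)
    ... | inj₂ I⊆J = subst (λ P → ∣ S ∣ + m + value W ≤ suc (suc m + value P)) (sym U∖I≡)
            (leaves-coloured k induction S⊆R (J⊆S ∘ I⊆J) (subst (∣ I ∣ ≤_) ∣J∣≡m (p⊆q⇒∣p∣≤∣q∣ I⊆J)) budget)
      where
      U∖I≡ : U ∖ I ≡ W ∪ (S ∖ I)
      U∖I≡ = ∪-∖-missˡ W S I (λ y∈I → R∩W=∅ (S⊆R (J⊆S (I⊆J y∈I))))

  leaves-bound : ∀ k → LeavesBound k
  leaves-bound zero    = leaves-base
  leaves-bound (suc k) = leaves-step k (leaves-bound k)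

lemma3p3 : (T : Graph) → Forest T → (v : Fin (n T)) → Stem T v →
           let R = leafNbrs T v
               r = ∣ R ∣
           in 1 ≤ r → Triangular (r + 1) →
           sc (T ─ R) + r + u r ≤ sc T
-- The theorem: take S = R in leaves-bound, where t (k + 1) = r + 1 gives
-- u r ≤ k, and identify sc (T ─ R) with the value of W in T.
lemma3p3 T _ v stem _ (zero  , ()  , _)
lemma3p3 T _ v stem _ (suc k , _ , t[k+1]≡r+1) = ≤-pred (begin
  suc (sc (T ─ R) + r + u r)  ≡⟨ cong (λ c → suc (c + r + u r)) (Deletion.sc-deletion T R) ⟩
  suc (value W + r + u r)     ≤⟨ s≤s (+-monoʳ-≤ (value W + r) (u-below r k t[k+1]≡1+r)) ⟩
  suc (value W + r + k)       ≡⟨ rearrange (value W) r k ⟩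
  r + suc k + value W         ≤⟨ leaves-bound k ⊆-refl (≤-reflexive t[k+1]≡1+r) ⟩
  suc (value (W ∪ R))         ≡⟨ cong (suc ∘ value) (sym V≡W∪R) ⟩
  suc (sc T)                  ∎)
  where
  open StemLeaves T v stem
  open Game T using (value)
  open ≤-Reasoning
  r = ∣ R ∣
  t[k+1]≡1+r : t (suc k) ≡ suc r
  t[k+1]≡1+r = trans t[k+1]≡r+1 (+-comm r 1)
  rearrange : ∀ w r k → suc (w + r + k) ≡ r + suc k + w
  rearrange = solve-∀
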